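{- Let $D=(V,E)$ be a directed graph with $n=|V|$ vertices, and let $s,t\in V$. Suppose $A$ and $B$ are $st$-embracing spanning trees of $D$. Then there exist $st$-embracing spanning trees $A=T_0,T_1,\dots,T_{q-1},T_q=B$ of $D$ with $q\le n-1$ such that $|T_{i-1}\triangle T_i|=2$ and $|T_i\cap B|\ge |T_{i-1}\cap B|$ for all $i\in\{1,\dots,q\}$.
   Context: A spanning tree of a directed graph $D=(V,E)$ is a subset $T\subseteq E$ of arcs whose underlying undirected graph is a spanning tree on $V$. For $u,v\in V$ and a spanning tree $T$, $T[u,v]$ denotes the unique path in the underlying tree from $u$ to $v$, with arcs keeping their orientation from $D$ (so it need not be a directed path). A spanning tree $T$ is called $st$-embracing if $T[s,t]$ is a directed path from $s$ to $t$, i.e., a sequence of arcs $v_0v_1, v_1v_2,\dots,v_{k-1}v_k$ of $D$ with $v_0=s$, $v_k=t$ and all $v_i$ distinct (this definition applies whether or not $st$ is itself an arc of $D$). -}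

module Defs where

open import Data.Nat using (ℕ; suc)
open import Data.Fin using (Fin)
open import Data.Fin.Subset using (Subset; _∈_; _∩_; _∪_; _─_; ∣_∣)
open import Data.List using (List; []; _∷_)
open import Data.List.Relation.Unary.Unique.Propositional using (Unique)
open import Data.Product using (Σ; ∃; _×_; _,_)
open import Relation.Binary.PropositionalEquality using (_≡_)
open import Relation.Nullary using (¬_)

-- A directed graph on vertex set Fin n with m arcs (indexed by Fin m);
-- arc e goes from tail e to head e.  (Loops / parallel arcs are allowed;
-- this only makes the statement more general.)
record Digraph (n m : ℕ) : Set where
  field
    tail : Fin m → Fin n
    head : Fin m → Fin n

ArcSet : ℕ → Set
ArcSet m = Subset m

module _ {n m : ℕ} (D : Digraph n m) (T : ArcSet m) where
  open Digraph D

  -- Walk u w vs es : a walk in the underlying undirected graph of T from u to w,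
  -- visiting vertices vs (in order, including both ends) and using arcs es
  -- (each arc may be traversed along or against its orientation).
  data Walk : Fin n → Fin n → List (Fin n) → List (Fin m) → Set where
    nil  : ∀ {v} → Walk v v (v ∷ []) []
    fwd  : ∀ {u w vs es} (e : Fin m) → e ∈ T → tail e ≡ u →
           Walk (head e) w vs es → Walk u w (u ∷ vs) (e ∷ es)
    bwd  : ∀ {u w vs es} (e : Fin m) → e ∈ T → head e ≡ u →
           Walk (tail e) w vs es → Walk u w (u ∷ vs) (e ∷ es)

  data DiWalk : Fin n → Fin n → List (Fin n) → List (Fin m) → Set where
    nil  : ∀ {v} → DiWalk v v (v ∷ []) []
    fwd  : ∀ {u w vs es} (e : Fin m) → e ∈ T → tail e ≡ u →
           DiWalk (head e) w vs es → DiWalk u w (u ∷ vs) (e ∷ es)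

  Connected : Set
  Connected = ∀ (u v : Fin n) → Σ (List (Fin n)) λ vs → Σ (List (Fin m)) λ es → Walk u v vs es

  -- A cycle: a closed walk u → u with at least one arc, pairwise distinct arcs,
  -- and pairwise distinct vertices apart from the repeated start/end vertex.
  IsCycle : Set
  IsCycle = Σ (Fin n) λ u → Σ (List (Fin n)) λ ws → Σ (Fin m) λ e → Σ (List (Fin m)) λ es →
            Walk u u (u ∷ ws) (e ∷ es) × Unique ws × Unique (e ∷ es)

  Acyclic : Set
  Acyclic = ¬ IsCycle

  SpanningTree : Set
  SpanningTree = Connected × Acyclic

  -- T is st-embracing: spanning tree whose tree path T[s,t] is a directed s–t path.
  -- Since the path between s and t in a tree is unique, this says: T contains a
  -- directed path (distinct vertices) from s to t.
  STEmbracing : Fin n → Fin n → Set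
  STEmbracing s t = SpanningTree ×
    (Σ (List (Fin n)) λ vs → Σ (List (Fin m)) λ es → DiWalk s t vs es × Unique vs)

_△_ : ∀ {m} → Subset m → Subset m → Subset m
X △ Y = (X ─ Y) ∪ (Y ─ X)

-- Root every spanning tree at s and describe it by a parent map: each vertex v ≠ s gets a parent
-- and a parent arc, and a depth decreases towards s. The tree path from s to t is then the chain of
-- parent arcs above t, so a tree is st-embracing iff every arc of that chain points away from s.
--
-- For a vertex set P ∋ s that is closed under B-parents, the tree T_P uses B's parent arcs on P and
-- A's outside P; T_{s} = A and T_V = B. Grow P one vertex w at a time, w having its B-parent in P
-- and, as long as t ∉ P, lying on B's s–t path. Then T_P stays st-embracing, and T_{P ∪ {w}} arises
-- from T_P by trading A's parent arc of w for B's: either nothing changes or one arc is exchanged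
-- for an arc of B. At most n − 1 vertices are added.

module Submission where

open import Defs
open import Data.Bool.Base using (if_then_else_)
open import Data.Empty using (⊥; ⊥-elim)
open import Data.Fin.Base using (Fin; zero; suc; fromℕ; inject₁)
open import Data.Fin.Properties using (_≟_; any?; all?; ¬∀⟶∃¬; toℕ<n)
open import Data.Fin.Subset using (Subset; _∈_; _∉_; _⊆_; _∩_; _∪_; _─_; ⁅_⁆; ∣_∣; inside; outside)
open import Data.Fin.Subset.Properties
  using (⊆-antisym; ∪-identityʳ; p⊆q⇒∣p∣≤∣q∣; p─q⊆p; x∈p∧x∉q⇒x∈p─q; x∈p∪q⁺; x∈p∪q⁻; x∈p∩q⁺; x∈p∩q⁻;
         x∈⁅x⁆; x∈⁅y⁆⇒x≡y; x≢y⇒x∉⁅y⁆; ∣⁅x⁆∣≡1; ∣p∣≡n⇒p≡⊤; ∈⊤)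
  renaming (_∈?_ to _∈ₛ?_)
open import Data.List.Base using ([]; _∷_; length; tabulate)
open import Data.List.Extrema.Nat using (max; xs≤max)
open import Data.List.Membership.Propositional using () renaming (_∈_ to _∈ₗ_)
open import Data.List.Membership.Propositional.Properties using (∈-tabulate⁺)
import Data.List.Membership.DecPropositional as DecMembership
open import Data.List.Relation.Unary.All as All using (All; []; _∷_)
open import Data.List.Relation.Unary.All.Properties using (¬Any⇒All¬; All¬⇒¬Any)
open import Data.List.Relation.Unary.Any using (here; there)
open import Data.List.Relation.Unary.AllPairs using ([]; _∷_)
open import Data.List.Relation.Unary.Unique.Propositional using (Unique)
open import Data.Nat.Base using (ℕ; zero; suc; _+_; _∸_; _≤_; _<_; z≤n; s≤s; s≤s⁻¹)
open import Data.Nat.Induction using (<-wellFounded)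
open import Data.Nat.Properties
  using (module ≤-Reasoning; ≤-refl; ≤-reflexive; ≤-trans; <⇒≤; <-irrefl; <-asym; <-≤-trans; ≤∧≢⇒<;
         n≤1+n; m≤n⇒m≤1+n; m≤m+n; +-monoʳ-<; +-suc; +-identityʳ; m+[n∸m]≡n)
open import Data.Product using (Σ; ∃; ∃₂; _×_; _,_; proj₁; proj₂)
import Data.Product as Product
open import Data.Sum using (_⊎_; inj₁; inj₂; [_,_])
import Data.Sum as Sum
open import Data.Unit using (⊤; tt)
open import Data.Vec.Base using ([]; _∷_; here; there)
import Data.Vec.Base as Vec
open import Data.Vec.Properties using (lookup∘tabulate; lookup⇒[]=; []=⇒lookup)
open import Function.Base using (_∘_; id)
open import Function.Bundles using (mk⇔)
import Induction.WellFounded as WF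
open import Level using (0ℓ)
import Relation.Binary.Construct.On as On
open import Relation.Binary.PropositionalEquality
  using (_≡_; _≢_; refl; sym; trans; cong; subst; subst₂; module ≡-Reasoning)
open import Relation.Nullary using (¬_; Dec; yes; no; does; contradiction)
open import Relation.Nullary.Decidable using (¬?; _×-dec_; _⊎-dec_; dec-true; dec-false; does-⇔)
open import Relation.Unary using (Decidable)

∃-least : ∀ {P : ℕ → Set} → Decidable P → ∀ {k} → P k → ∃ λ d → P d × (∀ {j} → P j → d ≤ j)
∃-least {P} P? {k} pk = search k 0 (λ _ → z≤n) (subst P (sym (+-identityʳ k)) pk)
  where
  search : ∀ fuel i → (∀ {j} → P j → i ≤ j) → P (fuel + i) → ∃ λ d → P d × (∀ {j} → P j → d ≤ j)
  search fuel i i≤ p with P? i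
  ... | yes pi = i , pi , i≤
  search zero i i≤ p | no ¬pi = contradiction p ¬pi
  search (suc fuel) i i≤ p | no ¬pi =
    search fuel (suc i) (λ pj → ≤∧≢⇒< (i≤ pj) λ { refl → ¬pi pj }) (subst P (sym (+-suc fuel i)) p)

bound : ∀ {k} → (Fin k → ℕ) → ℕ
bound f = suc (max 0 (tabulate f))

<-bound : ∀ {k} (f : Fin k → ℕ) i → f i < bound f
<-bound f i = s≤s (All.lookup (xs≤max 0 (tabulate f)) (∈-tabulate⁺ i))

module _ {k : ℕ} where

  fromDec : {P : Fin k → Set} → Decidable P → Subset k
  fromDec P? = Vec.tabulate (does ∘ P?)

  ∈-fromDec⁺ : ∀ {P : Fin k → Set} (P? : Decidable P) {x} → P x → x ∈ fromDec P?
  ∈-fromDec⁺ P? {x} px = lookup⇒[]= x _ (trans (lookup∘tabulate (does ∘ P?) x) (dec-true (P? x) px))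

  ∈-fromDec⁻ : ∀ {P : Fin k → Set} (P? : Decidable P) {x} → x ∈ fromDec P? → P x
  ∈-fromDec⁻ P? {x} x∈ with P? x | trans (sym (lookup∘tabulate (does ∘ P?) x)) ([]=⇒lookup x∈)
  ... | yes px | _ = px
  ... | no _ | ()

x∈p─q⇒x∉q : ∀ {k} {x : Fin k} (p q : Subset k) → x ∈ p ─ q → x ∉ q
x∈p─q⇒x∉q (_ ∷ p) (inside ∷ q) () here
x∈p─q⇒x∉q (_ ∷ p) (outside ∷ q) here ()
x∈p─q⇒x∉q (_ ∷ p) (_ ∷ q) (there x∈) (there x∈q) = x∈p─q⇒x∉q p q x∈ x∈q

∣p∪⁅x⁆∣≡1+∣p∣ : ∀ {k} {x : Fin k} (p : Subset k) → x ∉ p → ∣ p ∪ ⁅ x ⁆ ∣ ≡ suc ∣ p ∣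
∣p∪⁅x⁆∣≡1+∣p∣ {x = zero} (inside ∷ p) x∉ = contradiction here x∉
∣p∪⁅x⁆∣≡1+∣p∣ {x = zero} (outside ∷ p) _ = cong (suc ∘ ∣_∣) (∪-identityʳ p)
∣p∪⁅x⁆∣≡1+∣p∣ {x = suc x} (inside ∷ p) x∉ = cong suc (∣p∪⁅x⁆∣≡1+∣p∣ p (x∉ ∘ there))
∣p∪⁅x⁆∣≡1+∣p∣ {x = suc x} (outside ∷ p) x∉ = ∣p∪⁅x⁆∣≡1+∣p∣ p (x∉ ∘ there)

x∈p∪⁅y⁆⁻ : ∀ {k} {x : Fin k} (p : Subset k) y → x ∈ p ∪ ⁅ y ⁆ → x ∈ p ⊎ x ≡ y
x∈p∪⁅y⁆⁻ p y x∈ = Sum.map₂ (x∈⁅y⁆⇒x≡y y) (x∈p∪q⁻ p ⁅ y ⁆ x∈)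

∣p∪⁅x⁆∣≤1+∣p∣ : ∀ {k} (p : Subset k) x → ∣ p ∪ ⁅ x ⁆ ∣ ≤ suc ∣ p ∣
∣p∪⁅x⁆∣≤1+∣p∣ p x with x ∈ₛ? p
... | no x∉ = ≤-reflexive (∣p∪⁅x⁆∣≡1+∣p∣ p x∉)
... | yes x∈ = ≤-trans (p⊆q⇒∣p∣≤∣q∣ p∪⁅x⁆⊆p) (n≤1+n _)
  where
  p∪⁅x⁆⊆p : p ∪ ⁅ x ⁆ ⊆ p
  p∪⁅x⁆⊆p y∈ = [ id , (λ { refl → x∈ }) ] (x∈p∪⁅y⁆⁻ p x y∈)

Exchange : ∀ {k} → Subset k → Subset k → Subset k → Set
Exchange B X Y = ∣ X △ Y ∣ ≡ 2 × ∣ X ∩ B ∣ ≤ ∣ Y ∩ B ∣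

module _ {k} {X Y : Subset k} {a b : Fin k}
         (a∈X : a ∈ X) (a∉Y : a ∉ Y) (b∉X : b ∉ X) (b∈Y : b ∈ Y)
         (X⊆Y : ∀ {x} → x ≢ a → x ∈ X → x ∈ Y) (Y⊆X : ∀ {x} → x ≢ b → x ∈ Y → x ∈ X) where

  X△Y≡⁅a⁆∪⁅b⁆ : X △ Y ≡ ⁅ a ⁆ ∪ ⁅ b ⁆
  X△Y≡⁅a⁆∪⁅b⁆ = ⊆-antisym X△Y⊆ X△Y⊇
    where
    X△Y⊆ : X △ Y ⊆ ⁅ a ⁆ ∪ ⁅ b ⁆
    X△Y⊆ {x} x∈ with x ≟ a | x ≟ b
    ... | yes refl | _ = x∈p∪q⁺ (inj₁ (x∈⁅x⁆ a))
    ... | _ | yes refl = x∈p∪q⁺ (inj₂ (x∈⁅x⁆ b))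
    ... | no x≢a | no x≢b with x∈p∪q⁻ (X ─ Y) (Y ─ X) x∈
    ...   | inj₁ x∈X─Y = ⊥-elim (x∈p─q⇒x∉q X Y x∈X─Y (X⊆Y x≢a (p─q⊆p X Y x∈X─Y)))
    ...   | inj₂ x∈Y─X = ⊥-elim (x∈p─q⇒x∉q Y X x∈Y─X (Y⊆X x≢b (p─q⊆p Y X x∈Y─X)))
    X△Y⊇ : ⁅ a ⁆ ∪ ⁅ b ⁆ ⊆ X △ Y
    X△Y⊇ x∈ with x∈p∪⁅y⁆⁻ ⁅ a ⁆ b x∈
    ... | inj₁ x∈⁅a⁆ rewrite x∈⁅y⁆⇒x≡y a x∈⁅a⁆ = x∈p∪q⁺ (inj₁ (x∈p∧x∉q⇒x∈p─q a∈X a∉Y))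
    ... | inj₂ refl = x∈p∪q⁺ (inj₂ (x∈p∧x∉q⇒x∈p─q b∈Y b∉X))

  exchange : ∀ {B} → b ∈ B → Exchange B X Y
  exchange {B} b∈B = ∣X△Y∣≡2 , ∣X∩B∣≤∣Y∩B∣
    where
    ∣X△Y∣≡2 : ∣ X △ Y ∣ ≡ 2
    ∣X△Y∣≡2 = begin
      ∣ X △ Y ∣           ≡⟨ cong ∣_∣ X△Y≡⁅a⁆∪⁅b⁆ ⟩
      ∣ ⁅ a ⁆ ∪ ⁅ b ⁆ ∣   ≡⟨ ∣p∪⁅x⁆∣≡1+∣p∣ ⁅ a ⁆ (λ b∈⁅a⁆ → b∉X (subst (_∈ X) (sym (x∈⁅y⁆⇒x≡y a b∈⁅a⁆)) a∈X)) ⟩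
      suc ∣ ⁅ a ⁆ ∣       ≡⟨ cong suc (∣⁅x⁆∣≡1 a) ⟩
      2                   ∎
      where open ≡-Reasoning
    ∪⁅b⁆⊆∪⁅a⁆ : (X ∩ B) ∪ ⁅ b ⁆ ⊆ (Y ∩ B) ∪ ⁅ a ⁆
    ∪⁅b⁆⊆∪⁅a⁆ {x} x∈ with x∈p∪⁅y⁆⁻ (X ∩ B) b x∈ | x ≟ a
    ... | inj₂ refl | _ = x∈p∪q⁺ (inj₁ (x∈p∩q⁺ (b∈Y , b∈B)))
    ... | inj₁ _ | yes refl = x∈p∪q⁺ (inj₂ (x∈⁅x⁆ a))
    ... | inj₁ x∈X∩B | no x≢a =
          let (x∈X , x∈B) = x∈p∩q⁻ X B x∈X∩B in x∈p∪q⁺ (inj₁ (x∈p∩q⁺ (X⊆Y x≢a x∈X , x∈B)))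
    ∣X∩B∣≤∣Y∩B∣ : ∣ X ∩ B ∣ ≤ ∣ Y ∩ B ∣
    ∣X∩B∣≤∣Y∩B∣ = s≤s⁻¹ (begin
      suc ∣ X ∩ B ∣             ≡⟨ ∣p∪⁅x⁆∣≡1+∣p∣ (X ∩ B) (b∉X ∘ proj₁ ∘ x∈p∩q⁻ X B) ⟨
      ∣ (X ∩ B) ∪ ⁅ b ⁆ ∣       ≤⟨ p⊆q⇒∣p∣≤∣q∣ ∪⁅b⁆⊆∪⁅a⁆ ⟩
      ∣ (Y ∩ B) ∪ ⁅ a ⁆ ∣       ≤⟨ ∣p∪⁅x⁆∣≤1+∣p∣ (Y ∩ B) a ⟩
      suc ∣ Y ∩ B ∣             ∎)
      where open ≤-Reasoning

record Sequence {A : Set} (Good : A → Set) (Step : A → A → Set) (X Y : A) (q : ℕ) : Set where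
  constructor sequence
  field
    term  : Fin (suc q) → A
    first : term zero ≡ X
    last  : term (fromℕ q) ≡ Y
    good  : ∀ i → Good (term i)
    steps : ∀ (i : Fin q) → Step (term (inject₁ i)) (term (suc i))

module _ {A : Set} {Good : A → Set} {Step : A → A → Set} where

  done : ∀ {X} → Good X → Sequence Good Step X X 0
  done {X} goodX = sequence (λ _ → X) refl refl (λ _ → goodX) λ ()

  infixr 5 _∷⟨_⟩_
  _∷⟨_⟩_ : ∀ {X Y Z q} → Good X → Step X Y → Sequence Good Step Y Z q → Sequence Good Step X Z (suc q)
  _∷⟨_⟩_ {X} goodX step (sequence T T₀ Tq good steps) = sequence
    (λ { zero → X ; (suc i) → T i })
    refl
    Tq
    (λ { zero → goodX ; (suc i) → good i })
    (λ { zero → subst (Step X) (sym T₀) step ; (suc i) → steps i })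

if-does-yes : ∀ {P X : Set} (p? : Dec P) {x y : X} → P → (if does p? then x else y) ≡ x
if-does-yes p? p rewrite dec-true p? p = refl

if-does-no : ∀ {P X : Set} (p? : Dec P) {x y : X} → ¬ P → (if does p? then x else y) ≡ y
if-does-no p? ¬p rewrite dec-false p? ¬p = refl


module _ {n m : ℕ} (D : Digraph n m) where
  open Digraph D
  open DecMembership (_≟_ {n}) using () renaming (_∈?_ to _∈ₗ?_)

  Arc : Fin m → Fin n → Fin n → Set
  Arc e x y = tail e ≡ x × head e ≡ y

  Joins : Fin m → Fin n → Fin n → Set
  Joins e x y = Arc e x y ⊎ Arc e y x

  joins-sym : ∀ {e x y} → Joins e x y → Joins e y x
  joins-sym = Sum.swap

  joins-unique : ∀ {e x y u v} → Joins e x y → Joins e u v → (u ≡ x × v ≡ y) ⊎ (u ≡ y × v ≡ x)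
  joins-unique (inj₁ (refl , refl)) (inj₁ (refl , refl)) = inj₁ (refl , refl)
  joins-unique (inj₁ (refl , refl)) (inj₂ (refl , refl)) = inj₂ (refl , refl)
  joins-unique (inj₂ (refl , refl)) (inj₁ (refl , refl)) = inj₂ (refl , refl)
  joins-unique (inj₂ (refl , refl)) (inj₂ (refl , refl)) = inj₁ (refl , refl)

  fwd-joins : ∀ {e u} → tail e ≡ u → Joins e u (head e)
  fwd-joins p = inj₁ (p , refl)

  bwd-joins : ∀ {e u} → head e ≡ u → Joins e u (tail e)
  bwd-joins p = inj₂ (refl , p)

  joins? : ∀ e x y → Dec (Joins e x y)
  joins? e x y = ((tail e ≟ x) ×-dec (head e ≟ y)) ⊎-dec ((tail e ≟ y) ×-dec (head e ≟ x))

  Route : Subset m → Fin n → Fin n → Set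
  Route T u w = ∃₂ λ vs es → Walk D T u w vs es

  Path : Subset m → Fin n → Fin n → Set
  Path T u w = ∃₂ λ vs es → Walk D T u w vs es × Unique vs

  module _ {T : Subset m} where

    walk-∷ : ∀ {e u v w vs es} → e ∈ T → Joins e u v → Walk D T v w vs es → Walk D T u w (u ∷ vs) (e ∷ es)
    walk-∷ e∈ (inj₁ (refl , refl)) = fwd _ e∈ refl
    walk-∷ e∈ (inj₂ (refl , refl)) = bwd _ e∈ refl

    edge : ∀ {e u v} → e ∈ T → Joins e u v → Route T u v
    edge e∈ j = _ , _ , walk-∷ e∈ j nil

    walk-++ : ∀ {u v w vs es} → Walk D T u v vs es → Route T v w → Route T u w
    walk-++ nil r = r
    walk-++ (fwd e e∈ p w) r = let (_ , _ , w′) = walk-++ w r in _ , _ , walk-∷ e∈ (fwd-joins p) w′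
    walk-++ (bwd e e∈ p w) r = let (_ , _ , w′) = walk-++ w r in _ , _ , walk-∷ e∈ (bwd-joins p) w′

    infixr 5 _++_
    _++_ : ∀ {u v w} → Route T u v → Route T v w → Route T u w
    (_ , _ , w) ++ r = walk-++ w r

    reverse : ∀ {u w} → Route T u w → Route T w u
    reverse (_ , _ , nil) = _ , _ , nil
    reverse (_ , _ , fwd e e∈ p w) = reverse (_ , _ , w) ++ edge e∈ (joins-sym (fwd-joins p))
    reverse (_ , _ , bwd e e∈ p w) = reverse (_ , _ , w) ++ edge e∈ (joins-sym (bwd-joins p))

    start∈ : ∀ {u w vs es} → Walk D T u w vs es → u ∈ₗ vs
    start∈ nil = here refl
    start∈ (fwd _ _ _ _) = here refl
    start∈ (bwd _ _ _ _) = here refl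

    endpoints∈ : ∀ {u w vs es e} → Walk D T u w vs es → e ∈ₗ es → tail e ∈ₗ vs × head e ∈ₗ vs
    endpoints∈ (fwd _ _ refl w) (here refl) = here refl , there (start∈ w)
    endpoints∈ (bwd _ _ refl w) (here refl) = there (start∈ w) , here refl
    endpoints∈ (fwd _ _ _ w) (there e∈) = Product.map there there (endpoints∈ w e∈)
    endpoints∈ (bwd _ _ _ w) (there e∈) = Product.map there there (endpoints∈ w e∈)

    path-arcs-unique : ∀ {u w vs es} → Walk D T u w vs es → Unique vs → Unique es
    path-arcs-unique nil _ = []
    path-arcs-unique (fwd _ _ refl w) (u∉ ∷ uniq) =
      ¬Any⇒All¬ _ (All¬⇒¬Any u∉ ∘ proj₁ ∘ endpoints∈ w) ∷ path-arcs-unique w uniq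
    path-arcs-unique (bwd _ _ refl w) (u∉ ∷ uniq) =
      ¬Any⇒All¬ _ (All¬⇒¬Any u∉ ∘ proj₂ ∘ endpoints∈ w) ∷ path-arcs-unique w uniq

    suffix : ∀ {u w x vs es} → Walk D T u w vs es → Unique vs → x ∈ₗ vs → Path T x w
    suffix nil uniq (here refl) = _ , _ , nil , uniq
    suffix w@(fwd _ _ _ _) uniq (here refl) = _ , _ , w , uniq
    suffix w@(bwd _ _ _ _) uniq (here refl) = _ , _ , w , uniq
    suffix (fwd _ _ _ w) (_ ∷ uniq) (there x∈) = suffix w uniq x∈
    suffix (bwd _ _ _ w) (_ ∷ uniq) (there x∈) = suffix w uniq x∈

    path-∷ : ∀ {e u v w} → e ∈ T → Joins e u v → Path T v w → Path T u w
    path-∷ {u = u} e∈ j (vs , _ , w , uniq) with u ∈ₗ? vs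
    ... | yes u∈ = suffix w uniq u∈
    ... | no u∉ = _ , _ , walk-∷ e∈ j w , ¬Any⇒All¬ vs u∉ ∷ uniq

    walk⇒path : ∀ {u w vs es} → Walk D T u w vs es → Path T u w
    walk⇒path nil = _ , _ , nil , [] ∷ []
    walk⇒path (fwd e e∈ p w) = path-∷ e∈ (fwd-joins p) (walk⇒path w)
    walk⇒path (bwd e e∈ p w) = path-∷ e∈ (bwd-joins p) (walk⇒path w)

    walk-arcs∈ : ∀ {u w vs es} → Walk D T u w vs es → All (_∈ T) es
    walk-arcs∈ nil = []
    walk-arcs∈ (fwd _ e∈ _ w) = e∈ ∷ walk-arcs∈ w
    walk-arcs∈ (bwd _ e∈ _ w) = e∈ ∷ walk-arcs∈ w

    walk-mono : ∀ {T′ : Subset m} {u w vs es} → T ⊆ T′ → Walk D T u w vs es → Walk D T′ u w vs es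
    walk-mono T⊆ nil = nil
    walk-mono T⊆ (fwd e e∈ p w) = fwd e (T⊆ e∈) p (walk-mono T⊆ w)
    walk-mono T⊆ (bwd e e∈ p w) = bwd e (T⊆ e∈) p (walk-mono T⊆ w)

  DiPath : Subset m → Fin n → Fin n → Set
  DiPath T u w = ∃₂ λ vs es → DiWalk D T u w vs es × Unique vs

  distart∈ : ∀ {T u w vs es} → DiWalk D T u w vs es → u ∈ₗ vs
  distart∈ nil = here refl
  distart∈ (fwd _ _ _ _) = here refl

  -- Trees as parent maps

  module _ (s : Fin n) where

    -- The fields at the root s itself carry no meaning.
    record ParentMap : Set where
      field
        parent          : Fin n → Fin n
        parentArc       : Fin n → Fin m
        depth           : Fin n → ℕ
        parentArc-joins : ∀ {v} → v ≢ s → Joins (parentArc v) (parent v) v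
        depth-parent<   : ∀ {v} → v ≢ s → depth (parent v) < depth v

    module _ (pm : ParentMap) where
      open ParentMap pm

      IsParentArc : Fin m → Set
      IsParentArc e = ∃ λ v → v ≢ s × parentArc v ≡ e

      isParentArc? : Decidable IsParentArc
      isParentArc? e = any? λ v → ¬? (v ≟ s) ×-dec (parentArc v ≟ e)

      arcs : Subset m
      arcs = fromDec isParentArc?

      parentArc∈arcs : ∀ {v} → v ≢ s → parentArc v ∈ arcs
      parentArc∈arcs {v} v≢s = ∈-fromDec⁺ isParentArc? (v , v≢s , refl)

      ∈arcs⇒parentArc : ∀ {e} → e ∈ arcs → IsParentArc e
      ∈arcs⇒parentArc = ∈-fromDec⁻ isParentArc?

      parent-induction : (C : Fin n → Set) → C s → (∀ {v} → v ≢ s → C (parent v) → C v) → ∀ v → C v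
      parent-induction C Cs step = WF.All.wfRec (On.wellFounded depth <-wellFounded) 0ℓ C go
        where
        go : ∀ v → (∀ {w} → depth w < depth v → C w) → C v
        go v rec with v ≟ s
        ... | yes refl = Cs
        ... | no v≢s = step v≢s (rec (depth-parent< v≢s))

      route-to-root : ∀ v → Route arcs v s
      route-to-root = parent-induction (λ v → Route arcs v s) (_ , _ , nil)
        λ v≢s r → edge (parentArc∈arcs v≢s) (joins-sym (parentArc-joins v≢s)) ++ r

      arcs-connected : Connected D arcs
      arcs-connected u v = route-to-root u ++ reverse (route-to-root v)

      arc-parent-child : ∀ {e x y} → e ∈ arcs → Joins e x y →
        ∃ λ z → z ≢ s × parentArc z ≡ e × ((x ≡ parent z × y ≡ z) ⊎ (x ≡ z × y ≡ parent z))
      arc-parent-child e∈ j with ∈arcs⇒parentArc e∈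
      ... | z , z≢s , refl = z , z≢s , refl , joins-unique (parentArc-joins z≢s) j

      parentArc-injective : ∀ {x y} → x ≢ s → y ≢ s → parentArc x ≡ parentArc y → x ≡ y
      parentArc-injective {x} {y} x≢s y≢s eq
        with joins-unique (parentArc-joins x≢s) (subst (λ e → Joins e (parent y) y) (sym eq) (parentArc-joins y≢s))
      ... | inj₁ (_ , y≡x) = sym y≡x
      ... | inj₂ (py≡x , y≡px) = ⊥-elim (<-asym
            (subst (λ v → depth v < depth x) (sym y≡px) (depth-parent< x≢s))
            (subst (λ v → depth v < depth y) py≡x (depth-parent< y≢s)))

      data InSubtree (c : Fin n) : Fin n → Set where
        self  : InSubtree c c
        child : ∀ {v} → v ≢ s → InSubtree c (parent v) → InSubtree c v

      subtree-depth : ∀ {c v} → InSubtree c v → depth c ≤ depth v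
      subtree-depth self = ≤-refl
      subtree-depth (child v≢s c≤pv) = ≤-trans (subtree-depth c≤pv) (<⇒≤ (depth-parent< v≢s))

      parent∉subtree : ∀ {v} → v ≢ s → ¬ InSubtree v (parent v)
      parent∉subtree v≢s v≤pv = <-irrefl refl (<-≤-trans (depth-parent< v≢s) (subtree-depth v≤pv))

      subtree-step : ∀ {c e x y} → e ∈ arcs → parentArc c ≢ e → Joins e x y → InSubtree c x → InSubtree c y
      subtree-step e∈ e≢ j c≤x with arc-parent-child e∈ j
      ... | z , z≢s , refl , inj₁ (refl , refl) = child z≢s c≤x
      ... | z , z≢s , refl , inj₂ (refl , refl) with c≤x
      ...   | self = contradiction refl e≢
      ...   | child _ c≤pz = c≤pz

      walk-subtree : ∀ {c x y vs es} → Walk D arcs x y vs es → All (parentArc c ≢_) es →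
                     (InSubtree c x → InSubtree c y) × (InSubtree c y → InSubtree c x)
      walk-subtree nil [] = id , id
      walk-subtree (fwd e e∈ p w) (e≢ ∷ e≢s) =
        let (to , from) = walk-subtree w e≢s
        in to ∘ subtree-step e∈ e≢ (fwd-joins p) , subtree-step e∈ e≢ (joins-sym (fwd-joins p)) ∘ from
      walk-subtree (bwd e e∈ p w) (e≢ ∷ e≢s) =
        let (to , from) = walk-subtree w e≢s
        in to ∘ subtree-step e∈ e≢ (bwd-joins p) , subtree-step e∈ e≢ (joins-sym (bwd-joins p)) ∘ from

      closing-arc-absurd : ∀ {e u y ws es} → e ∈ arcs → Joins e u y → Walk D arcs y u ws es → All (e ≢_) es → ⊥
      closing-arc-absurd e∈ j w e∉ with arc-parent-child e∈ j
      ... | z , z≢s , refl , inj₁ (refl , refl) = parent∉subtree z≢s (proj₁ (walk-subtree w e∉) self)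
      ... | z , z≢s , refl , inj₂ (refl , refl) = parent∉subtree z≢s (proj₂ (walk-subtree w e∉) self)

      arcs-acyclic : Acyclic D arcs
      arcs-acyclic (_ , _ , _ , _ , fwd _ e∈ p w , _ , e∉ ∷ _) = closing-arc-absurd e∈ (fwd-joins p) w e∉
      arcs-acyclic (_ , _ , _ , _ , bwd _ e∈ p w , _ , e∉ ∷ _) = closing-arc-absurd e∈ (bwd-joins p) w e∉

      data DirectedRootPath : Fin n → Set where
        root : DirectedRootPath s
        down : ∀ {v} → v ≢ s → Arc (parentArc v) (parent v) v → DirectedRootPath (parent v) → DirectedRootPath v

      directed-parent : ∀ {v} → v ≢ s → DirectedRootPath v → DirectedRootPath (parent v)
      directed-parent v≢s root = contradiction refl v≢s
      directed-parent _ (down _ _ d) = d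

      directed⇒diPath : ∀ {t} → DirectedRootPath t → DiPath arcs s t
      directed⇒diPath d = go d nil ([] ∷ []) (≤-refl ∷ [])
        where
        go : ∀ {x t vs es} → DirectedRootPath x → DiWalk D arcs x t vs es → Unique vs →
             All (λ y → depth x ≤ depth y) vs → DiPath arcs s t
        go root w uniq _ = _ , _ , w , uniq
        go {x} (down x≢s (tl , hd) d) w uniq deeper =
          go d (fwd _ (parentArc∈arcs x≢s) tl (subst (λ v → DiWalk D arcs v _ _ _) (sym hd) w))
             (All.map (λ x≤y px≡y → <-irrefl (cong depth px≡y) (<-≤-trans (depth-parent< x≢s) x≤y)) deeper ∷ uniq)
             (≤-refl ∷ All.map (≤-trans (<⇒≤ (depth-parent< x≢s))) deeper)

      diPath⇒directed : ∀ {t} → DiPath arcs s t → DirectedRootPath t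
      diPath⇒directed (_ , _ , w , uniq) = go root w uniq (inj₁ refl)
        where
        go : ∀ {x t vs es} → DirectedRootPath x → DiWalk D arcs x t vs es → Unique vs →
             x ≡ s ⊎ All (parent x ≢_) vs → DirectedRootPath t
        go-arc : ∀ {e x y t vs es} → DirectedRootPath x → e ∈ arcs → Arc e x y → DiWalk D arcs y t vs es → Unique vs →
                 All (x ≢_) vs → x ≡ s ⊎ All (parent x ≢_) (x ∷ vs) → DirectedRootPath t
        go d nil _ _ = d
        go d (fwd e e∈ p w) (x∉ ∷ uniq) fresh = go-arc d e∈ (p , refl) w uniq x∉ fresh
        go-arc d e∈ a w uniq x∉ fresh with arc-parent-child e∈ (inj₁ a)
        ... | z , z≢s , refl , inj₁ (refl , refl) = go (down z≢s a d) w uniq (inj₂ x∉)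
        ... | z , z≢s , refl , inj₂ (refl , refl) with fresh
        ...   | inj₁ z≡s = contradiction z≡s z≢s
        ...   | inj₂ (_ ∷ pz∉) = contradiction (distart∈ w) (All¬⇒¬Any pz∉)

      directed⇒embracing : ∀ {t} → DirectedRootPath t → STEmbracing D arcs s t
      directed⇒embracing d = (arcs-connected , arcs-acyclic) , directed⇒diPath d

    -- Breadth-first parent maps of spanning trees

    -- e₀ only fills the parent-arc slot of the root.
    module _ {T : Subset m} (connected : Connected D T) (e₀ : Fin m) where

      ReachIn : ℕ → Fin n → Set
      ReachIn zero v = v ≡ s
      ReachIn (suc k) v = ∃ λ e → e ∈ T × ∃ λ w → Joins e v w × ReachIn k w

      reachIn? : ∀ k → Decidable (ReachIn k)
      reachIn? zero v = v ≟ s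
      reachIn? (suc k) v = any? λ e → (e ∈ₛ? T) ×-dec any? λ w → joins? e v w ×-dec reachIn? k w

      walk⇒reachIn : ∀ {v vs es} → Walk D T v s vs es → ReachIn (length es) v
      walk⇒reachIn nil = refl
      walk⇒reachIn (fwd e e∈ p w) = e , e∈ , _ , fwd-joins p , walk⇒reachIn w
      walk⇒reachIn (bwd e e∈ p w) = e , e∈ , _ , bwd-joins p , walk⇒reachIn w

      distance : ∀ v → ∃ λ d → ReachIn d v × (∀ {k} → ReachIn k v → d ≤ k)
      distance v = ∃-least (λ k → reachIn? k v) (walk⇒reachIn (proj₂ (proj₂ (connected v s))))

      dist : Fin n → ℕ
      dist v = proj₁ (distance v)

      nearer-neighbour : ∀ v → v ≢ s → ∃ λ e → e ∈ T × ∃ λ w → Joins e v w × dist w < dist v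
      nearer-neighbour v v≢s with distance v
      ... | zero , v≡s , _ = contradiction v≡s v≢s
      ... | suc d , (e , e∈ , w , j , r) , _ = e , e∈ , w , j , s≤s (proj₂ (proj₂ (distance w)) r)

      ParentChoice : Fin n → Set
      ParentChoice v = Σ (Fin m × Fin n) λ (e , w) → v ≢ s → e ∈ T × Joins e w v × dist w < dist v

      choose-parent : ∀ v → Dec (v ≡ s) → ParentChoice v
      choose-parent v (yes v≡s) = (e₀ , v) , λ v≢s → contradiction v≡s v≢s
      choose-parent v (no v≢s) =
        let (e , e∈ , w , j , closer) = nearer-neighbour v v≢s in (e , w) , λ _ → e∈ , joins-sym j , closer

      parent-choice : ∀ v → ParentChoice v
      parent-choice v = choose-parent v (v ≟ s)

      bfs : ParentMap
      bfs = record
        { parent          = proj₂ ∘ proj₁ ∘ parent-choice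
        ; parentArc       = proj₁ ∘ proj₁ ∘ parent-choice
        ; depth           = dist
        ; parentArc-joins = λ {v} v≢s → proj₁ (proj₂ (proj₂ (parent-choice v) v≢s))
        ; depth-parent<   = λ {v} v≢s → proj₂ (proj₂ (proj₂ (parent-choice v) v≢s))
        }

      arcs-bfs⊆ : arcs bfs ⊆ T
      arcs-bfs⊆ e∈ with ∈arcs⇒parentArc bfs e∈
      ... | v , v≢s , refl = proj₁ (proj₂ (parent-choice v) v≢s)

      ⊆arcs-bfs : Acyclic D T → T ⊆ arcs bfs
      ⊆arcs-bfs acyclic {e} e∈T with e ∈ₛ? arcs bfs
      ... | yes e∈ = e∈
      ... | no e∉ with walk⇒path (proj₂ (proj₂ (arcs-connected bfs (head e) (tail e))))
      ...   | _ , _ , w , uniq = ⊥-elim (acyclic (_ , _ , e , _ , fwd e e∈T refl (walk-mono arcs-bfs⊆ w) , uniq ,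
                 All.map (λ a∈ e≡a → e∉ (subst (_∈ arcs bfs) (sym e≡a) a∈)) (walk-arcs∈ w) ∷ path-arcs-unique w uniq))

    spanningTree⇒parentMap : ∀ {T} → SpanningTree D T → Fin m → Σ ParentMap λ pm → arcs pm ≡ T
    spanningTree⇒parentMap (connected , acyclic) e₀ =
      bfs connected e₀ , ⊆-antisym (arcs-bfs⊆ connected e₀) (⊆arcs-bfs connected e₀ acyclic)

    -- Comparing and mixing parent maps

    Agree : ParentMap → ParentMap → Fin n → Set
    Agree pm pm′ v = ParentMap.parent pm v ≡ ParentMap.parent pm′ v × ParentMap.parentArc pm v ≡ ParentMap.parentArc pm′ v

    module _ {pm pm′ : ParentMap} where
      open ParentMap

      down-agree : ∀ {v} → Agree pm pm′ v → v ≢ s → Arc (parentArc pm v) (parent pm v) v →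
                   DirectedRootPath pm′ (parent pm v) → DirectedRootPath pm′ v
      down-agree (p≡ , a≡) v≢s arc d = down v≢s (subst₂ (λ e x → Arc e x _) a≡ p≡ arc) (subst (DirectedRootPath pm′) p≡ d)

      directed-transport : (Q : Fin n → Set) → (∀ {v} → v ≢ s → Q v → Q (parent pm v) × Agree pm pm′ v) →
                           ∀ {x} → Q x → DirectedRootPath pm x → DirectedRootPath pm′ x
      directed-transport Q step q root = root
      directed-transport Q step q (down v≢s arc d) =
        let (q′ , agree) = step v≢s q in down-agree agree v≢s arc (directed-transport Q step q′ d)

      arcs-⊆ : (∀ {v} → v ≢ s → parentArc pm v ≡ parentArc pm′ v) → arcs pm ⊆ arcs pm′
      arcs-⊆ same e∈ with ∈arcs⇒parentArc pm e∈
      ... | v , v≢s , refl = subst (_∈ arcs pm′) (sym (same v≢s)) (parentArc∈arcs pm′ v≢s)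

      module _ {v : Fin n} (v≢s : v ≢ s) (off : ∀ {x} → x ≢ v → parentArc pm x ≡ parentArc pm′ x) where

        kept∈ : ∀ {e} → e ≢ parentArc pm v → e ∈ arcs pm → e ∈ arcs pm′
        kept∈ e≢ e∈ with ∈arcs⇒parentArc pm e∈
        ... | x , x≢s , refl with x ≟ v
        ...   | yes refl = contradiction refl e≢
        ...   | no x≢v = subst (_∈ arcs pm′) (sym (off x≢v)) (parentArc∈arcs pm′ x≢s)

        dropped∉ : parentArc pm v ≢ parentArc pm′ v → parentArc pm v ∉ arcs pm′
        dropped∉ differ a∈ with ∈arcs⇒parentArc pm′ a∈
        ... | x , x≢s , eq with x ≟ v
        ...   | yes refl = differ (sym eq)
        ...   | no x≢v = x≢v (parentArc-injective pm x≢s v≢s (trans (off x≢v) eq))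

    arcs-cong : ∀ {pm pm′} → (∀ {v} → v ≢ s → ParentMap.parentArc pm v ≡ ParentMap.parentArc pm′ v) → arcs pm ≡ arcs pm′
    arcs-cong {pm} {pm′} same = ⊆-antisym (arcs-⊆ {pm} {pm′} same) (arcs-⊆ {pm′} {pm} λ v≢s → sym (same v≢s))

    parentArc-exchange : ∀ {pm pm′ v} → v ≢ s →
      (∀ {x} → x ≢ v → ParentMap.parentArc pm x ≡ ParentMap.parentArc pm′ x) →
      ParentMap.parentArc pm v ≢ ParentMap.parentArc pm′ v →
      ∀ {B} → ParentMap.parentArc pm′ v ∈ B → Exchange B (arcs pm) (arcs pm′)
    parentArc-exchange {pm} {pm′} v≢s off differ =
      exchange (parentArc∈arcs pm v≢s) (dropped∉ {pm} {pm′} v≢s off differ)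
               (dropped∉ {pm′} {pm} v≢s (λ x≢v → sym (off x≢v)) (differ ∘ sym)) (parentArc∈arcs pm′ v≢s)
               (kept∈ {pm} {pm′} v≢s off) (kept∈ {pm′} {pm} v≢s λ x≢v → sym (off x≢v))

    module Mix (A B : ParentMap) where
      open ParentMap

      Closed : Subset n → Set
      Closed P = ∀ {v} → v ∈ P → v ≢ s → parent B v ∈ P

      choose : Subset n → Fin n → ParentMap
      choose P v = if does (v ∈ₛ? P) then B else A

      shift : ℕ
      shift = bound (depth B)

      -- Outside P the A-depth is lifted above every B-depth, so depth still decreases from a vertex
      -- outside P to a parent inside P.
      rank : Subset n → Fin n → ℕ
      rank P v = if does (v ∈ₛ? P) then depth B v else shift + depth A v

      rank<shift+ : ∀ P {w k} → depth A w < k → rank P w < shift + k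
      rank<shift+ P {w} {k} lt = by-cases (w ∈ₛ? P)
        where
        open ≤-Reasoning
        by-cases : Dec (w ∈ P) → rank P w < shift + k
        by-cases (yes w∈) = begin-strict
          rank P w   ≡⟨ if-does-yes (w ∈ₛ? P) w∈ ⟩
          depth B w  <⟨ <-bound (depth B) w ⟩
          shift      ≤⟨ m≤m+n shift k ⟩
          shift + k  ∎
        by-cases (no w∉) = begin-strict
          rank P w           ≡⟨ if-does-no (w ∈ₛ? P) w∉ ⟩
          shift + depth A w  <⟨ +-monoʳ-< shift lt ⟩
          shift + k          ∎

      rank-parent< : ∀ {P} → Closed P → ∀ {v} → v ≢ s → rank P (parent (choose P v) v) < rank P v
      rank-parent< {P} closed {v} v≢s = by-cases (v ∈ₛ? P)
        where
        open ≤-Reasoning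
        by-cases : Dec (v ∈ P) → rank P (parent (choose P v) v) < rank P v
        by-cases (yes v∈) = begin-strict
          rank P (parent (choose P v) v)  ≡⟨ cong (λ pm → rank P (parent pm v)) (if-does-yes (v ∈ₛ? P) v∈) ⟩
          rank P (parent B v)             ≡⟨ if-does-yes (parent B v ∈ₛ? P) (closed v∈ v≢s) ⟩
          depth B (parent B v)            <⟨ depth-parent< B v≢s ⟩
          depth B v                       ≡⟨ if-does-yes (v ∈ₛ? P) v∈ ⟨
          rank P v                        ∎
        by-cases (no v∉) = begin-strict
          rank P (parent (choose P v) v)  ≡⟨ cong (λ pm → rank P (parent pm v)) (if-does-no (v ∈ₛ? P) v∉) ⟩
          rank P (parent A v)             <⟨ rank<shift+ P (depth-parent< A v≢s) ⟩
          shift + depth A v               ≡⟨ if-does-no (v ∈ₛ? P) v∉ ⟨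
          rank P v                        ∎

      module _ {P} (closed : Closed P) where

        mix : ParentMap
        mix = record
          { parent          = λ v → parent (choose P v) v
          ; parentArc       = λ v → parentArc (choose P v) v
          ; depth           = rank P
          ; parentArc-joins = λ {v} → parentArc-joins (choose P v)
          ; depth-parent<   = rank-parent< closed
          }

        choice-agree : ∀ {v} pm → choose P v ≡ pm → Agree pm mix v
        choice-agree _ refl = refl , refl

        mix-in : ∀ {v} → v ∈ P → Agree B mix v
        mix-in {v} v∈ = choice-agree B (if-does-yes (v ∈ₛ? P) v∈)

        mix-out : ∀ {v} → v ∉ P → Agree A mix v
        mix-out {v} v∉ = choice-agree A (if-does-no (v ∈ₛ? P) v∉)

        directed-in : ∀ {x} → x ∈ P → DirectedRootPath B x → DirectedRootPath mix x
        directed-in = directed-transport (_∈ P) λ v≢s v∈ → closed v∈ v≢s , mix-in v∈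

        arcs-mix-full : (∀ v → v ∈ P) → arcs mix ≡ arcs B
        arcs-mix-full full = arcs-cong {mix} {B} λ {v} _ → sym (proj₂ (mix-in (full v)))

      closed₀ : Closed ⁅ s ⁆
      closed₀ v∈ v≢s = contradiction (x∈⁅y⁆⇒x≡y s v∈) v≢s

      arcs-mix₀ : arcs (mix closed₀) ≡ arcs A
      arcs-mix₀ = arcs-cong {mix closed₀} {A} λ v≢s → sym (proj₂ (mix-out closed₀ (x≢y⇒x∉⁅y⁆ v≢s)))

      directed-mix₀ : ∀ {x} → DirectedRootPath A x → DirectedRootPath (mix closed₀) x
      directed-mix₀ = directed-transport (λ _ → ⊤) (λ v≢s _ → tt , mix-out closed₀ (x≢y⇒x∉⁅y⁆ v≢s)) tt

      module _ {P} (closed : Closed P) {w} (pw∈ : parent B w ∈ P) where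

        closed⁺ : Closed (P ∪ ⁅ w ⁆)
        closed⁺ v∈ v≢s with x∈p∪⁅y⁆⁻ P w v∈
        ... | inj₁ v∈P = x∈p∪q⁺ (inj₁ (closed v∈P v≢s))
        ... | inj₂ refl = x∈p∪q⁺ (inj₁ pw∈)

        w∈⁺ : w ∈ P ∪ ⁅ w ⁆
        w∈⁺ = x∈p∪q⁺ (inj₂ (x∈⁅x⁆ w))

        mix-off : ∀ {x} → x ≢ w → Agree (mix closed) (mix closed⁺) x
        mix-off {x} x≢w =
          choice-agree closed⁺ (choose P x) (cong (λ b → if b then B else A) (does-⇔ (mk⇔ ⁺⊆ ⊆⁺) (x ∈ₛ? (P ∪ ⁅ w ⁆)) (x ∈ₛ? P)))
          where
          ⊆⁺ : x ∈ P → x ∈ P ∪ ⁅ w ⁆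
          ⊆⁺ x∈ = x∈p∪q⁺ (inj₁ x∈)
          ⁺⊆ : x ∈ P ∪ ⁅ w ⁆ → x ∈ P
          ⁺⊆ x∈ = [ id , (λ x≡w → contradiction x≡w x≢w) ] (x∈p∪⁅y⁆⁻ P w x∈)

        directed-extend : DirectedRootPath B w → ∀ {x} → DirectedRootPath (mix closed) x → DirectedRootPath (mix closed⁺) x
        directed-extend w↓ root = root
        directed-extend w↓ (down {x} x≢s arc d) with x ≟ w
        ... | yes refl = directed-in closed⁺ w∈⁺ w↓
        ... | no x≢w = down-agree {mix closed} {mix closed⁺} (mix-off x≢w) x≢s arc (directed-extend w↓ d)

        extend-step : w ∉ P → w ≢ s →
                      arcs (mix closed) ≡ arcs (mix closed⁺) ⊎ Exchange (arcs B) (arcs (mix closed)) (arcs (mix closed⁺))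
        extend-step w∉ w≢s with parentArc A w ≟ parentArc B w
        ... | yes same = inj₁ (arcs-cong {mix closed} {mix closed⁺} λ {x} _ → arc-agree x)
          where
          arc-agree : ∀ x → parentArc (mix closed) x ≡ parentArc (mix closed⁺) x
          arc-agree x with x ≟ w
          ... | yes refl = trans (sym (proj₂ (mix-out closed w∉))) (trans same (proj₂ (mix-in closed⁺ w∈⁺)))
          ... | no x≢w = proj₂ (mix-off x≢w)
        ... | no differ = inj₂ (parentArc-exchange {mix closed} {mix closed⁺} w≢s (λ x≢w → proj₂ (mix-off x≢w))
                  (λ eq → differ (trans (proj₂ (mix-out closed w∉)) (trans eq (sym (proj₂ (mix-in closed⁺ w∈⁺))))))
                  (subst (_∈ arcs B) (proj₂ (mix-in closed⁺ w∈⁺)) (parentArc∈arcs B w≢s)))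

    -- The exchange sequence

    module _ (A B : ParentMap) {t : Fin n} (B↓t : DirectedRootPath B t) where
      open Mix A B
      open ParentMap B using (parent)

      Embracing : Subset m → Set
      Embracing X = STEmbracing D X s t

      Improving : Subset m → Subset m → ℕ → Set
      Improving = Sequence Embracing (Exchange (arcs B))

      -- The last component says that w lies on the B-root path of x.
      Frontier : Subset n → Fin n → Set
      Frontier P x = ∃ λ w → w ∉ P × w ≢ s × parent w ∈ P × (DirectedRootPath B x → DirectedRootPath B w)

      frontier : ∀ {P} → s ∈ P → ∀ x → x ∉ P → Frontier P x
      frontier {P} s∈ = parent-induction B (λ x → x ∉ P → Frontier P x) (λ s∉ → contradiction s∈ s∉) climb
        where
        climb : ∀ {v} → v ≢ s → (parent v ∉ P → Frontier P (parent v)) → v ∉ P → Frontier P v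
        climb {v} v≢s ih v∉ with parent v ∈ₛ? P
        ... | yes pv∈ = v , v∉ , v≢s , pv∈ , id
        ... | no pv∉ = let (w , w∉ , w≢s , pw∈ , lift) = ih pv∉ in w , w∉ , w≢s , pw∈ , lift ∘ directed-parent B v≢s

      finished : ∀ {P} (closed : Closed P) → (∀ v → v ∈ P) → Improving (arcs (mix closed)) (arcs B) 0
      finished closed full =
        subst (λ X → Improving X (arcs B) 0) (sym (arcs-mix-full closed full)) (done (directed⇒embracing B B↓t))

      size-extend : ∀ {P : Subset n} {w k} → w ∉ P → ∣ P ∣ + suc k ≡ n → ∣ P ∪ ⁅ w ⁆ ∣ + k ≡ n
      size-extend {P} {w} {k} w∉ size = begin
        ∣ P ∪ ⁅ w ⁆ ∣ + k  ≡⟨ cong (_+ k) (∣p∪⁅x⁆∣≡1+∣p∣ P w∉) ⟩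
        suc ∣ P ∣ + k      ≡⟨ +-suc ∣ P ∣ k ⟨
        ∣ P ∣ + suc k      ≡⟨ size ⟩
        n                  ∎
        where open ≡-Reasoning

      grow : ∀ k {P} (closed : Closed P) → s ∈ P → DirectedRootPath (mix closed) t → ∣ P ∣ + k ≡ n →
             ∃ λ q → q ≤ k × Improving (arcs (mix closed)) (arcs B) q

      advance : ∀ k {P} (closed : Closed P) → s ∈ P → DirectedRootPath (mix closed) t → ∣ P ∣ + suc k ≡ n →
                ∀ {w} (w∉ : w ∉ P) → w ≢ s → (pw∈ : parent w ∈ P) → DirectedRootPath (mix (closed⁺ closed pw∈)) t →
                ∃ λ q → q ≤ suc k × Improving (arcs (mix closed)) (arcs B) q
      advance k closed s∈ t↓ size w∉ w≢s pw∈ t↓⁺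
        with grow k (closed⁺ closed pw∈) (x∈p∪q⁺ (inj₁ s∈)) t↓⁺ (size-extend w∉ size) | extend-step closed pw∈ w∉ w≢s
      ... | q , q≤ , seq | inj₁ same = q , m≤n⇒m≤1+n q≤ , subst (λ X → Improving X (arcs B) q) (sym same) seq
      ... | q , q≤ , seq | inj₂ exch = suc q , s≤s q≤ , directed⇒embracing (mix closed) t↓ ∷⟨ exch ⟩ seq

      grow zero closed _ _ size =
        0 , z≤n , finished closed λ v → subst (v ∈_) (sym (∣p∣≡n⇒p≡⊤ (trans (sym (+-identityʳ _)) size))) ∈⊤
      grow (suc k) {P} closed s∈ t↓ size with all? (_∈ₛ? P)
      ... | yes full = 0 , z≤n , finished closed full
      ... | no ¬full with t ∈ₛ? P
      ...   | yes t∈ = let (v , v∉) = ¬∀⟶∃¬ n _ (_∈ₛ? P) ¬full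
                           (w , w∉ , w≢s , pw∈ , _) = frontier s∈ v v∉
                       in advance k closed s∈ t↓ size w∉ w≢s pw∈ (directed-in (closed⁺ closed pw∈) (x∈p∪q⁺ (inj₁ t∈)) B↓t)
      ...   | no t∉ = let (w , w∉ , w≢s , pw∈ , lift) = frontier s∈ t t∉
                      in advance k closed s∈ t↓ size w∉ w≢s pw∈ (directed-extend closed pw∈ (lift B↓t) t↓)

      exchange-sequence : DirectedRootPath A t → ∃ λ q → q ≤ n ∸ 1 × Improving (arcs A) (arcs B) q
      exchange-sequence A↓t =
        let (q , q≤ , seq) = grow (n ∸ 1) closed₀ (x∈⁅x⁆ s) (directed-mix₀ A↓t) size₀
        in q , q≤ , subst (λ X → Improving X (arcs B) q) arcs-mix₀ seq
        where
        size₀ : ∣ ⁅ s ⁆ ∣ + (n ∸ 1) ≡ n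
        size₀ = trans (cong (_+ (n ∸ 1)) (∣⁅x⁆∣≡1 s)) (m+[n∸m]≡n (≤-trans (s≤s z≤n) (toℕ<n s)))

theorem2p1 : ∀ {n m : ℕ} (D : Digraph n m) (s t : Fin n) (A B : Subset m) →
    STEmbracing D A s t → STEmbracing D B s t →
    Σ ℕ λ q → Σ (Fin (suc q) → Subset m) λ T →
      q ≤ n ∸ 1 × T zero ≡ A × T (fromℕ q) ≡ B ×
      (∀ (i : Fin (suc q)) → STEmbracing D (T i) s t) ×
      (∀ (i : Fin q) → ∣ T (inject₁ i) △ T (suc i) ∣ ≡ 2 ×
                       ∣ T (inject₁ i) ∩ B ∣ ≤ ∣ T (suc i) ∩ B ∣)
theorem2p1 {m = 0} D s t [] [] embA _ = 0 , (λ _ → []) , z≤n , refl , refl , (λ _ → embA) , λ ()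
theorem2p1 {m = suc _} D s t A B (treeA , pathA) (treeB , pathB)
  with spanningTree⇒parentMap D s treeA zero | spanningTree⇒parentMap D s treeB zero
... | pmA , refl | pmB , refl =
  let q , q≤ , sequence T first last good steps =
        exchange-sequence D s pmA pmB (diPath⇒directed D s pmB pathB) (diPath⇒directed D s pmA pathA)
  in q , T , q≤ , first , last , good , steps
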